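{- The maps $\mathrm{Join}$ and $\mathrm{Split}$ are mutually inverse bijections between $\mathrm{IPF}^*$ (finite lists of increasing parking functions, identified up to appending or removing trailing empty lists) and the set of finite weakly increasing sequences of positive integers.
   Context: An increasing parking function (IPF) of length $\ell\ge 0$ is a weakly increasing sequence $(a_1,\dots,a_\ell)$ of positive integers with $a_j\le j$ for all $j$ (the empty sequence is an IPF). $\mathrm{IPF}^*$ is the set of finite lists $(\mathbf{a}^{(1)},\dots,\mathbf{a}^{(r)})$ of IPFs of arbitrary (possibly zero, possibly different) lengths; such a list is regarded as an infinite list in which all entries after the $r$-th are empty, so lists differing only by trailing empty IPFs are identified. For a list $\mathbf{a}=(a_1,\dots,a_k)$ and integer $x$, write $\mathbf{a}\oplus x=(a_1+x,\dots,a_k+x)$, $\mathbf{a}\ominus x=(a_1-x,\dots,a_k-x)$, and $\bullet$ for concatenation. $\mathrm{Join}$: given $(\mathbf{a}^{(1)},\dots,\mathbf{a}^{(r)})\in\mathrm{IPF}^*$, let $\ell_i=|\mathbf{a}^{(i)}|$, $L_i=\ell_1+\dots+\ell_i$, $L_0=0$, and $\mathbf{b}^{(i)}=\mathbf{a}^{(i)}\oplus(L_{i-1}+i-1)$; then $\mathrm{Join}(\mathbf{a}^{(1)},\dots,\mathbf{a}^{(r)})=\mathbf{b}^{(1)}\bullet\cdots\bullet\mathbf{b}^{(r)}$. $\mathrm{Split}$: for a weakly increasing sequence $\mathbf{p}$ of positive integers, $\mathrm{Split}(())=()$; otherwise let $\mathbf{a}$ be the longest prefix of $\mathbf{p}$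 that is an IPF (possibly empty) and write $\mathbf{p}=\mathbf{a}\bullet\mathbf{q}$; if $\mathbf{q}$ is empty then $\mathrm{Split}(\mathbf{p})=(\mathbf{a})$, and otherwise $\mathrm{Split}(\mathbf{p})$ is the list $\mathbf{a}$ followed by the entries of $\mathrm{Split}(\mathbf{q}\ominus(|\mathbf{a}|+1))$. -}

module Defs where

open import Data.Nat using (ℕ; zero; suc; _+_; _∸_; _≤_; _≤?_)
open import Data.Nat.Properties using (≤-refl)
open import Data.List using (List; []; _∷_; map; _++_; length; take; drop; replicate)
open import Data.Nat.ListAction using (sum)
open import Data.List.Relation.Unary.All using (All; all?)
open import Data.List.Relation.Unary.Linked using (Linked; linked?)
open import Data.Product using (_×_; _,_; ∃₂)
open import Data.Unit using (⊤; tt)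
open import Relation.Nullary using (Dec; yes; no; ¬_)
open import Relation.Nullary.Decidable using (_×-dec_; ⌊_⌋)
open import Relation.Binary.PropositionalEquality using (_≡_)
open import Data.Bool using (if_then_else_)

WeaklyIncreasing : List ℕ → Set
WeaklyIncreasing = Linked _≤_

Positive : List ℕ → Set
Positive = All (1 ≤_)

WIPos : List ℕ → Set
WIPos p = WeaklyIncreasing p × Positive p

-- Bounded k (a_k, a_{k+1}, ...) : a_j ≤ j for all j (entries indexed from k)
Bounded : ℕ → List ℕ → Set
Bounded k []       = ⊤
Bounded k (x ∷ xs) = x ≤ k × Bounded (suc k) xs

IsIPF : List ℕ → Set
IsIPF a = WeaklyIncreasing a × Positive a × Bounded 1 a

bounded? : ∀ k xs → Dec (Bounded k xs)
bounded? k []       = yes tt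
bounded? k (x ∷ xs) = (x ≤? k) ×-dec bounded? (suc k) xs

isIPF? : ∀ a → Dec (IsIPF a)
isIPF? a = linked? _≤?_ a ×-dec (all? (1 ≤?_) a ×-dec bounded? 1 a)

IsIPFStar : List (List ℕ) → Set
IsIPFStar = All IsIPF

_≈*_ : List (List ℕ) → List (List ℕ) → Set
A ≈* B = ∃₂ λ m n → A ++ replicate m [] ≡ B ++ replicate n []

_⊕_ : List ℕ → ℕ → List ℕ
a ⊕ x = map (_+ x) a

_⊖_ : List ℕ → ℕ → List ℕ
a ⊖ x = map (_∸ x) a

-- Join: joinFrom L i (a^(i+1), ...) with L = L_i, shift by L_i + i
joinFrom : ℕ → ℕ → List (List ℕ) → List ℕ
joinFrom L i []       = []
joinFrom L i (a ∷ as) = (a ⊕ (L + i)) ++ joinFrom (L + length a) (suc i) as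

Join : List (List ℕ) → List ℕ
Join = joinFrom 0 0

searchIPF : ℕ → List ℕ → ℕ
searchIPF zero    p = 0
searchIPF (suc k) p = if ⌊ isIPF? (take (suc k) p) ⌋ then suc k else searchIPF k p

longestIPFPrefixLength : List ℕ → ℕ
longestIPFPrefixLength p = searchIPF (length p) p

-- Split with a fuel argument (recursion terminates since sum p + length p strictly decreases)
splitF : ℕ → List ℕ → List (List ℕ)
splitF f       []       = []
splitF zero    (x ∷ xs) = []
splitF (suc f) (x ∷ xs) = step (drop k p)
  where
  p = x ∷ xs
  k = longestIPFPrefixLength p
  step : List ℕ → List (List ℕ)
  step []       = take k p ∷ []
  step (y ∷ ys) = take k p ∷ splitF f ((y ∷ ys) ⊖ (k + 1))

Split : List ℕ → List (List ℕ)
Split p = splitF (suc (sum p + length p)) p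

module Submission where

-- Everything rests on one normal form for Join:
--   Join (a ∷ as) ≡ a ++ Join as ⊕ (|a| + 1),
-- i.e. Join writes the first IPF a unchanged and then the join of the remaining IPFs,
-- shifted strictly above |a| + 1.  From it, Join yields sorted positive sequences
-- (entries of an IPF a are at most |a| + 1) and ignores trailing empty IPFs.
--
-- Split peels off the longest IPF prefix t of p.  Two facts about this prefix drive the
-- rest: if p is sorted and positive, every entry after t exceeds |t| + 1 (otherwise t
-- could be extended), and conversely in a block a ++ q ⊕ (|a| + 1) with a an IPF and q
-- positive the longest IPF prefix is exactly a (the next entry violates a_j ≤ j).
-- Split is defined with fuel; by induction on the fuel, the first fact gives
-- Join ∘ Split ≡ id together with Split p ∈ IPF*, and the second gives
-- Split ∘ Join ≈* id.  Fuel suc (sum p + length p) suffices since the recursive call is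
-- on a list of strictly smaller weight.

open import Defs
open import Data.Nat using (ℕ; zero; suc; _+_; _∸_; _≤_; _<_; z≤n; s≤s; s≤s⁻¹; _<?_)
open import Data.Nat.Properties
open import Data.Nat.Tactic.RingSolver using (solve-∀)
open import Data.Nat.ListAction using (sum)
open import Data.List using (List; []; _∷_; [_]; map; _++_; length; take; drop; replicate)
open import Data.List.Properties using (map-++; ++-identityʳ; length-++; length-take; take++drop≡id)
import Data.List.Relation.Unary.All as All
open All using (All; []; _∷_)
import Data.List.Relation.Unary.All.Properties as Allₚ
import Data.List.Relation.Unary.Linked as Linked
open Linked using (Linked; []; [-]; _∷_)
import Data.List.Relation.Unary.Linked.Properties as Linkedₚ
open import Data.Product using (_×_; _,_; proj₁; proj₂; ∃)
open import Data.Unit using (tt)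
open import Data.Empty using (⊥-elim)
open import Data.Sum using (inj₁; inj₂)
open import Relation.Nullary using (yes; no; ¬_)
open import Relation.Binary.PropositionalEquality using (_≡_; refl; sym; trans; cong; cong₂; subst; subst₂; module ≡-Reasoning)

⊕-identityʳ : ∀ xs → xs ⊕ 0 ≡ xs
⊕-identityʳ []       = refl
⊕-identityʳ (x ∷ xs) = cong₂ _∷_ (+-identityʳ x) (⊕-identityʳ xs)

⊕-⊕ : ∀ xs m n → (xs ⊕ m) ⊕ n ≡ xs ⊕ (m + n)
⊕-⊕ []       m n = refl
⊕-⊕ (x ∷ xs) m n = cong₂ _∷_ (+-assoc x m n) (⊕-⊕ xs m n)

⊕-⊖ : ∀ xs c → (xs ⊕ c) ⊖ c ≡ xs
⊕-⊖ []       c = refl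
⊕-⊖ (x ∷ xs) c = cong₂ _∷_ (m+n∸n≡m x c) (⊕-⊖ xs c)

⊖-⊕ : ∀ {c} xs → All (c ≤_) xs → (xs ⊖ c) ⊕ c ≡ xs
⊖-⊕ []       []         = refl
⊖-⊕ (x ∷ xs) (c≤x ∷ ps) = cong₂ _∷_ (m∸n+n≡m c≤x) (⊖-⊕ xs ps)

⊕-≡[] : ∀ xs c → xs ⊕ c ≡ [] → xs ≡ []
⊕-≡[] [] c _ = refl

joinFrom-shift : ∀ L i A → joinFrom L i A ≡ Join A ⊕ (L + i)
joinFrom-shift L i []       = refl
joinFrom-shift L i (a ∷ as) = begin
  a ⊕ (L + i) ++ joinFrom (L + length a) (suc i) as
    ≡⟨ cong₂ _++_ (sym (⊕-⊕ a 0 (L + i))) (joinFrom-shift (L + length a) (suc i) as) ⟩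
  (a ⊕ 0) ⊕ (L + i) ++ Join as ⊕ (L + length a + suc i)
    ≡⟨ cong (λ n → (a ⊕ 0) ⊕ (L + i) ++ Join as ⊕ n) (offsets L (length a) i) ⟩
  (a ⊕ 0) ⊕ (L + i) ++ Join as ⊕ (length a + 1 + (L + i))
    ≡⟨ cong ((a ⊕ 0) ⊕ (L + i) ++_) (sym (⊕-⊕ (Join as) (length a + 1) (L + i))) ⟩
  (a ⊕ 0) ⊕ (L + i) ++ (Join as ⊕ (length a + 1)) ⊕ (L + i)
    ≡⟨ cong (λ xs → (a ⊕ 0) ⊕ (L + i) ++ xs ⊕ (L + i)) (sym (joinFrom-shift (length a) 1 as)) ⟩
  (a ⊕ 0) ⊕ (L + i) ++ joinFrom (length a) 1 as ⊕ (L + i)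
    ≡⟨ map-++ (_+ (L + i)) (a ⊕ 0) _ ⟨
  Join (a ∷ as) ⊕ (L + i) ∎
  where
  open ≡-Reasoning
  offsets : ∀ L l i → L + l + suc i ≡ l + 1 + (L + i)
  offsets = solve-∀

Join-cons : ∀ a as → Join (a ∷ as) ≡ a ++ Join as ⊕ (length a + 1)
Join-cons a as = cong₂ _++_ (⊕-identityʳ a) (joinFrom-shift (length a) 1 as)

Join-trailing : ∀ A m → Join (A ++ replicate m []) ≡ Join A
Join-trailing []       zero    = refl
Join-trailing []       (suc m) = trans (Join-cons [] (replicate m [])) (cong (_⊕ 1) (Join-trailing [] m))
Join-trailing (a ∷ as) m       = begin
  Join (a ∷ as ++ replicate m [])                   ≡⟨ Join-cons a (as ++ replicate m []) ⟩
  a ++ Join (as ++ replicate m []) ⊕ (length a + 1) ≡⟨ cong (λ q → a ++ q ⊕ _) (Join-trailing as m) ⟩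
  a ++ Join as ⊕ (length a + 1)                     ≡⟨ Join-cons a as ⟨
  Join (a ∷ as) ∎
  where open ≡-Reasoning

Join-≈* : ∀ {A B} → A ≈* B → Join A ≡ Join B
Join-≈* {A} {B} (m , n , eq) = trans (sym (Join-trailing A m)) (trans (cong Join eq) (Join-trailing B n))

Join-empty : ∀ A → Join A ≡ [] → ∃ λ m → A ≡ replicate m []
Join-empty []              _ = 0 , refl
Join-empty ([] ∷ as)       e with Join-empty as (⊕-≡[] (Join as) 1 (trans (sym (Join-cons [] as)) e))
... | m , as≡ = suc m , cong ([] ∷_) as≡
Join-empty ((x ∷ a) ∷ as) ()

Linked-++ : ∀ {m} xs ys → Linked _≤_ xs → Linked _≤_ ys →
            All (_≤ m) xs → All (m ≤_) ys → Linked _≤_ (xs ++ ys)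
Linked-++ []            ys       _           sy _          _         = sy
Linked-++ (x ∷ [])      []       _           _  _          _         = [-]
Linked-++ (x ∷ [])      (y ∷ ys) _           sy (x≤m ∷ []) (m≤y ∷ _) = ≤-trans x≤m m≤y ∷ sy
Linked-++ (x ∷ x′ ∷ xs) ys       (x≤x′ ∷ sx) sy (_ ∷ bx)   by        = x≤x′ ∷ Linked-++ (x′ ∷ xs) ys sx sy bx by

Linked-++⁻ : ∀ xs ys → Linked _≤_ (xs ++ ys) → Linked _≤_ xs × Linked _≤_ ys
Linked-++⁻ []            ys       s           = [] , s
Linked-++⁻ (x ∷ [])      []       _           = [-] , []
Linked-++⁻ (x ∷ [])      (y ∷ ys) (_ ∷ s)     = [-] , s
Linked-++⁻ (x ∷ x′ ∷ xs) ys       (x≤x′ ∷ s) with Linked-++⁻ (x′ ∷ xs) ys s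
... | sx , sy = x≤x′ ∷ sx , sy

WIPos-++⁻ : ∀ xs ys → WIPos (xs ++ ys) → WIPos xs × WIPos ys
WIPos-++⁻ xs ys (s , pos) with Linked-++⁻ xs ys s | Allₚ.++⁻ xs pos
... | sx , sy | px , py = (sx , px) , (sy , py)

WIPos-take : ∀ n p → WIPos p → WIPos (take n p)
WIPos-take n p wp = proj₁ (WIPos-++⁻ (take n p) (drop n p) (subst WIPos (sym (take++drop≡id n p)) wp))

⊕-sorted : ∀ {xs} c → Linked _≤_ xs → Linked _≤_ (xs ⊕ c)
⊕-sorted c s = Linkedₚ.map⁺ (Linked.map (+-monoˡ-≤ c) s)

⊖-WIPos : ∀ {c} xs → Linked _≤_ xs → All (c <_) xs → WIPos (xs ⊖ c)
⊖-WIPos {c} xs s above =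
  Linkedₚ.map⁺ (Linked.map (∸-monoˡ-≤ c) s) , Allₚ.map⁺ (All.map m<n⇒0<n∸m above)

Bounded-All : ∀ k a → Bounded k a → All (_≤ k + length a) a
Bounded-All k []      _              = []
Bounded-All k (x ∷ a) (x≤k , bound) =
  ≤-trans x≤k (m≤m+n k _) ∷ subst (λ n → All (_≤ n) a) (sym (+-suc k (length a))) (Bounded-All (suc k) a bound)

Bounded-snoc : ∀ k a y → Bounded k a → y ≤ k + length a → Bounded k (a ++ [ y ])
Bounded-snoc k []      y _              y≤ = subst (y ≤_) (+-identityʳ k) y≤ , tt
Bounded-snoc k (x ∷ a) y (x≤k , bound) y≤ =
  x≤k , Bounded-snoc (suc k) a y bound (subst (y ≤_) (+-suc k (length a)) y≤)

Bounded-mid : ∀ k a y ys → Bounded k (a ++ y ∷ ys) → y ≤ k + length a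
Bounded-mid k []      y ys (y≤k , _) = subst (y ≤_) (sym (+-identityʳ k)) y≤k
Bounded-mid k (x ∷ a) y ys (_ , bound) = subst (y ≤_) (sym (+-suc k (length a))) (Bounded-mid (suc k) a y ys bound)

IPF-snoc : ∀ a y → IsIPF a → WIPos (a ++ [ y ]) → y ≤ suc (length a) → IsIPF (a ++ [ y ])
IPF-snoc a y (_ , _ , bound) (s , pos) y≤ = s , pos , Bounded-snoc 1 a y bound y≤

-- Join produces sorted positive sequences: an IPF a has entries at most |a| + 1, below
-- the shifted remainder Join as ⊕ (|a| + 1), whose entries are at least |a| + 2.
Join-WIPos : ∀ A → IsIPFStar A → WIPos (Join A)
Join-WIPos []       []                  = [] , []
Join-WIPos (a ∷ as) ((sa , pa , ba) ∷ ias) = subst WIPos (sym (Join-cons a as)) (sorted , positive)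
  where
  c : ℕ
  c = length a + 1
  q : List ℕ
  q = Join as
  wq : WIPos q
  wq = Join-WIPos as ias
  above : All (suc c ≤_) (q ⊕ c)
  above = Allₚ.map⁺ (All.map (+-monoˡ-≤ c) (proj₂ wq))
  below : All (_≤ c) a
  below = subst (λ n → All (_≤ n) a) (+-comm 1 (length a)) (Bounded-All 1 a ba)
  sorted : Linked _≤_ (a ++ q ⊕ c)
  sorted = Linked-++ a (q ⊕ c) sa (⊕-sorted c (proj₁ wq)) below (All.map (≤-trans (n≤1+n c)) above)
  positive : Positive (a ++ q ⊕ c)
  positive = Allₚ.++⁺ pa (All.map (≤-trans (s≤s z≤n)) above)

take-length-++ : ∀ {A : Set} (a b : List A) → take (length a) (a ++ b) ≡ a
take-length-++ []      b = refl
take-length-++ (x ∷ a) b = cong (x ∷_) (take-length-++ a b)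

drop-length-++ : ∀ {A : Set} (a b : List A) → drop (length a) (a ++ b) ≡ b
drop-length-++ []      b = refl
drop-length-++ (x ∷ a) b = drop-length-++ a b

take-mid : ∀ {A : Set} (a : List A) y ys o → take (suc (length a + o)) (a ++ y ∷ ys) ≡ a ++ y ∷ take o ys
take-mid []      y ys o = refl
take-mid (x ∷ a) y ys o = cong (x ∷_) (take-mid a y ys o)

take-suc-drop : ∀ {A : Set} k (p : List A) {y ys} → drop k p ≡ y ∷ ys → take (suc k) p ≡ take k p ++ [ y ]
take-suc-drop zero    (x ∷ p) refl = refl
take-suc-drop (suc k) (x ∷ p) eq   = cong (x ∷_) (take-suc-drop k p eq)

drop-nonempty : ∀ {A : Set} k (p : List A) {y ys} → drop k p ≡ y ∷ ys → k < length p
drop-nonempty zero    (x ∷ p) _  = s≤s z≤n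
drop-nonempty (suc k) (x ∷ p) eq = s≤s (drop-nonempty k p eq)

longest : List ℕ → ℕ
longest = longestIPFPrefixLength

search-IPF : ∀ n p → IsIPF (take (searchIPF n p) p)
search-IPF zero    p = [] , [] , tt
search-IPF (suc n) p with isIPF? (take (suc n) p)
... | yes ipf = ipf
... | no  _   = search-IPF n p

search-maximal : ∀ n p j → searchIPF n p < j → j ≤ n → ¬ IsIPF (take j p)
search-maximal zero    p j l<j j≤n = ⊥-elim (<⇒≱ l<j j≤n)
search-maximal (suc n) p j l<j j≤n with isIPF? (take (suc n) p)
... | yes _   = ⊥-elim (<⇒≱ l<j j≤n)
... | no  ¬ipf with m≤n⇒m<n∨m≡n j≤n
...   | inj₁ j<1+n = search-maximal n p j l<j (s≤s⁻¹ j<1+n)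
...   | inj₂ refl  = ¬ipf

search-unique : ∀ n p l → l ≤ n → IsIPF (take l p) →
                (∀ j → l < j → j ≤ n → ¬ IsIPF (take j p)) → searchIPF n p ≡ l
search-unique zero    p .zero z≤n _ _ = refl
search-unique (suc n) p l l≤n ipf maximal with isIPF? (take (suc n) p) | m≤n⇒m<n∨m≡n l≤n
... | yes ipf′ | inj₁ l<1+n = ⊥-elim (maximal (suc n) l<1+n ≤-refl ipf′)
... | yes _    | inj₂ l≡1+n = sym l≡1+n
... | no  ¬ipf | inj₁ l<1+n =
  search-unique n p l (s≤s⁻¹ l<1+n) ipf (λ j l<j j≤n → maximal j l<j (m≤n⇒m≤1+n j≤n))
... | no  ¬ipf | inj₂ refl  = ⊥-elim (¬ipf ipf)

-- After the longest IPF prefix of a sorted positive p, the next entry exceeds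
-- longest p + 1: otherwise appending it would give a longer IPF prefix.
longest-gap : ∀ p {y ys} → WIPos p → drop (longest p) p ≡ y ∷ ys → longest p + 1 < y
longest-gap p {y} wp eq with longest p + 1 <? y
... | yes gap = gap
... | no ¬gap = ⊥-elim (search-maximal (length p) p (suc k) ≤-refl k<|p| extended)
  where
  k : ℕ
  k = longest p
  t : List ℕ
  t = take k p
  k<|p| : k < length p
  k<|p| = drop-nonempty k p eq
  t++y : take (suc k) p ≡ t ++ [ y ]
  t++y = take-suc-drop k p eq
  |t| : length t ≡ k
  |t| = trans (length-take k p) (m≤n⇒m⊓n≡m (<⇒≤ k<|p|))
  y≤ : y ≤ suc (length t)
  y≤ = subst (λ n → y ≤ suc n) (sym |t|) (subst (y ≤_) (+-comm k 1) (≮⇒≥ ¬gap))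
  extended : IsIPF (take (suc k) p)
  extended = subst IsIPF (sym t++y)
    (IPF-snoc t y (search-IPF (length p) p) (subst WIPos t++y (WIPos-take (suc k) p wp)) y≤)

-- In a block a ++ q ⊕ (|a| + 1) with a an IPF and q positive, the longest IPF prefix
-- is a: any longer prefix contains the entry z + |a| + 1 > |a| + 1 at position |a| + 1.
longest-block : ∀ a q → IsIPF a → Positive q → longest (a ++ q ⊕ (length a + 1)) ≡ length a
longest-block a q ipf pq =
  search-unique _ _ (length a) |a|≤ (subst IsIPF (sym (take-length-++ a _)) ipf) (longer pq)
  where
  c : ℕ
  c = length a + 1
  |a|≤ : length a ≤ length (a ++ q ⊕ c)
  |a|≤ = subst (length a ≤_) (sym (length-++ a)) (m≤m+n (length a) _)
  longer : ∀ {q} → Positive q → ∀ j → length a < j → j ≤ length (a ++ q ⊕ c) → ¬ IsIPF (take j (a ++ q ⊕ c))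
  longer {[]}     _          j |a|<j j≤ _ =
    <⇒≱ |a|<j (subst (j ≤_) (trans (length-++ a) (+-identityʳ (length a))) j≤)
  longer {z ∷ zs} (1≤z ∷ _) j |a|<j j≤ ipf′ with m≤n⇒∃[o]m+o≡n |a|<j
  ... | o , refl = <⇒≱ (+-monoˡ-≤ c 1≤z) (subst (z + c ≤_) (+-comm 1 (length a)) bound)
    where
    bound : z + c ≤ 1 + length a
    bound = Bounded-mid 1 a (z + c) _ (proj₂ (proj₂ (subst IsIPF (take-mid a (z + c) (zs ⊕ c) o) ipf′)))

splitF-last : ∀ f x xs → drop (longest (x ∷ xs)) (x ∷ xs) ≡ [] →
              splitF (suc f) (x ∷ xs) ≡ take (longest (x ∷ xs)) (x ∷ xs) ∷ []
splitF-last f x xs eq rewrite eq = refl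

splitF-cons : ∀ f p {y ys} → drop (longest p) p ≡ y ∷ ys →
              splitF (suc f) p ≡ take (longest p) p ∷ splitF f ((y ∷ ys) ⊖ (longest p + 1))
splitF-cons f (x ∷ xs) eq rewrite eq = refl

-- The weight sum p + length p: Split is given fuel exceeding it, and every recursive
-- call of Split is on a lighter list.
weight : List ℕ → ℕ
weight []       = 0
weight (x ∷ xs) = suc (x + weight xs)

weight≡ : ∀ p → weight p ≡ sum p + length p
weight≡ []       = refl
weight≡ (x ∷ xs) = trans (cong (λ n → suc (x + n)) (weight≡ xs))
  (trans (cong suc (sym (+-assoc x (sum xs) (length xs)))) (sym (+-suc (x + sum xs) (length xs))))

weight-++ʳ : ∀ xs ys → weight ys ≤ weight (xs ++ ys)
weight-++ʳ []       ys = ≤-refl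
weight-++ʳ (x ∷ xs) ys = ≤-trans (weight-++ʳ xs ys) (≤-trans (m≤n+m _ x) (n≤1+n _))

weight-⊕ : ∀ xs c → weight xs ≤ weight (xs ⊕ c)
weight-⊕ []       c = z≤n
weight-⊕ (x ∷ xs) c = s≤s (+-mono-≤ (m≤m+n x c) (weight-⊕ xs c))

weight-⊕-suc : ∀ y ys c → weight (y ∷ ys) < weight ((y ∷ ys) ⊕ (c + 1))
weight-⊕-suc y ys c = s≤s (+-mono-<-≤ (m<m+n y 0<c+1) (weight-⊕ ys (c + 1)))
  where
  0<c+1 : 0 < c + 1
  0<c+1 = subst (0 <_) (+-comm 1 c) (s≤s z≤n)

enough-fuel : ∀ p → weight p < suc (sum p + length p)
enough-fuel p = s≤s (≤-reflexive (weight≡ p))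

-- With enough fuel, Split cuts p into IPFs that Join reassembles
-- into p: the first
-- piece is the longest IPF prefix t, and the remainder r has all entries above |t| + 1,
-- so r ⊖ (|t| + 1) is again sorted and positive, and lighter than p.
split-correct : ∀ f p → WIPos p → weight p < f → IsIPFStar (splitF f p) × Join (splitF f p) ≡ p
split-correct f       []       _  _ = [] , refl
split-correct zero    (x ∷ xs) _  ()
split-correct (suc f) p@(x ∷ xs) wp w<f = by-rest (drop (longest p) p) refl
  where
  k : ℕ
  k = longest p
  t : List ℕ
  t = take k p
  c : ℕ
  c = k + 1
  t++r : ∀ {r} → drop k p ≡ r → t ++ r ≡ p
  t++r rest = trans (cong (t ++_) (sym rest)) (take++drop≡id k p)

  by-rest : ∀ r → drop k p ≡ r → IsIPFStar (splitF (suc f) p) × Join (splitF (suc f) p) ≡ p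
  by-rest [] rest = subst (λ S → IsIPFStar S × Join S ≡ p) (sym (splitF-last f x xs rest))
    (search-IPF (length p) p ∷ [] , trans (Join-cons t []) (t++r rest))
  by-rest r@(y ∷ ys) rest = subst (λ S → IsIPFStar S × Join S ≡ p) (sym (splitF-cons f p rest))
    (search-IPF (length p) p ∷ proj₁ ih , joined)
    where
    sorted-r : Linked _≤_ r
    sorted-r = proj₁ (proj₂ (WIPos-++⁻ t r (subst WIPos (sym (t++r rest)) wp)))
    above : All (c <_) r
    above = Linkedₚ.Linked⇒All ≤-trans (longest-gap p wp rest) sorted-r
    unshift : (r ⊖ c) ⊕ c ≡ r
    unshift = ⊖-⊕ r (All.map <⇒≤ above)
    lighter : weight (r ⊖ c) < f
    lighter = <-≤-trans (subst (λ q → weight (r ⊖ c) < weight q) unshift (weight-⊕-suc (y ∸ c) (ys ⊖ c) k))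
                        (≤-trans (subst (λ q → weight r ≤ weight q) (t++r rest) (weight-++ʳ t r)) (s≤s⁻¹ w<f))
    ih : IsIPFStar (splitF f (r ⊖ c)) × Join (splitF f (r ⊖ c)) ≡ r ⊖ c
    ih = split-correct f (r ⊖ c) (⊖-WIPos r sorted-r above) lighter
    |t| : length t ≡ k
    |t| = trans (length-take k p) (m≤n⇒m⊓n≡m (<⇒≤ (drop-nonempty k p rest)))
    joined : Join (t ∷ splitF f (r ⊖ c)) ≡ p
    joined = begin
      Join (t ∷ splitF f (r ⊖ c))                   ≡⟨ Join-cons t (splitF f (r ⊖ c)) ⟩
      t ++ Join (splitF f (r ⊖ c)) ⊕ (length t + 1) ≡⟨ cong (λ n → t ++ Join (splitF f (r ⊖ c)) ⊕ (n + 1)) |t| ⟩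
      t ++ Join (splitF f (r ⊖ c)) ⊕ c              ≡⟨ cong (λ q → t ++ q ⊕ c) (proj₂ ih) ⟩
      t ++ (r ⊖ c) ⊕ c                              ≡⟨ cong (t ++_) unshift ⟩
      t ++ r                                        ≡⟨ t++r rest ⟩
      p ∎
      where open ≡-Reasoning

Join-first-cut : ∀ a as → IsIPF a → IsIPFStar as → let p = Join (a ∷ as) in
                 longest p ≡ length a × take (longest p) p ≡ a × drop (longest p) p ≡ Join as ⊕ (length a + 1)
Join-first-cut a as ia ias rewrite Join-cons a as
                                 | longest-block a (Join as) ia (proj₂ (Join-WIPos as ias)) =
  refl , take-length-++ a _ , drop-length-++ a _

cons-≈* : ∀ a {A B} → A ≈* B → (a ∷ A) ≈* (a ∷ B)
cons-≈* a (m , n , eq) = m , n , cong (a ∷_) eq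

split-join : ∀ f A p → IsIPFStar A → Join A ≡ p → weight p < f → splitF f p ≈* A
split-join f       A        []         _          e  _ with Join-empty A e
... | m , refl = m , 0 , sym (++-identityʳ (replicate m []))
split-join zero    A        (x ∷ xs)   _          _  ()
split-join (suc f) []       (x ∷ xs)   _          () _
split-join (suc f) (a ∷ as) p@(x ∷ xs) (ia ∷ ias) e  w<f = by-rest (Join as) refl
  where
  c : ℕ
  c = length a + 1
  cut : longest p ≡ length a × take (longest p) p ≡ a × drop (longest p) p ≡ Join as ⊕ c
  cut = subst (λ p → longest p ≡ length a × take (longest p) p ≡ a × drop (longest p) p ≡ Join as ⊕ c)
              e (Join-first-cut a as ia ias)
  longest≡ : longest p ≡ length a
  longest≡ = proj₁ cut
  take≡ : take (longest p) p ≡ a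
  take≡ = proj₁ (proj₂ cut)
  drop≡ : drop (longest p) p ≡ Join as ⊕ c
  drop≡ = proj₂ (proj₂ cut)

  by-rest : ∀ q → Join as ≡ q → splitF (suc f) p ≈* (a ∷ as)
  by-rest [] eq with Join-empty as eq
  ... | m , as≡ = subst (_≈* (a ∷ as)) (sym one-piece)
                    (m , 0 , cong₂ _∷_ take≡ (trans (sym as≡) (sym (++-identityʳ as))))
    where
    one-piece : splitF (suc f) p ≡ take (longest p) p ∷ []
    one-piece = splitF-last f x xs (trans drop≡ (cong (_⊕ c) eq))
  by-rest (z ∷ zs) eq = subst (_≈* (a ∷ as)) (sym unfolded) (cons-≈* a ih)
    where
    unfolded : splitF (suc f) p ≡ a ∷ splitF f (z ∷ zs)
    unfolded = begin
      splitF (suc f) p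
        ≡⟨ splitF-cons f p (trans drop≡ (cong (_⊕ c) eq)) ⟩
      take (longest p) p ∷ splitF f (((z ∷ zs) ⊕ c) ⊖ (longest p + 1))
        ≡⟨ cong₂ (λ t k → t ∷ splitF f (((z ∷ zs) ⊕ c) ⊖ (k + 1))) take≡ longest≡ ⟩
      a ∷ splitF f (((z ∷ zs) ⊕ c) ⊖ c)
        ≡⟨ cong (λ q → a ∷ splitF f q) (⊕-⊖ (z ∷ zs) c) ⟩
      a ∷ splitF f (z ∷ zs) ∎
      where open ≡-Reasoning
    tail≤p : weight ((z ∷ zs) ⊕ c) ≤ weight p
    tail≤p = subst₂ (λ q p′ → weight (q ⊕ c) ≤ weight p′) eq (trans (sym (Join-cons a as)) e)
                    (weight-++ʳ a (Join as ⊕ c))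
    ih : splitF f (z ∷ zs) ≈* as
    ih = split-join f as (z ∷ zs) ias eq (<-≤-trans (weight-⊕-suc z zs (length a)) (≤-trans tail≤p (s≤s⁻¹ w<f)))

theorem3p4 :
    ((A : List (List ℕ)) → IsIPFStar A → WIPos (Join A))
    × ((A B : List (List ℕ)) → IsIPFStar A → IsIPFStar B → A ≈* B → Join A ≡ Join B)
    × ((p : List ℕ) → WIPos p → IsIPFStar (Split p))
    × ((A : List (List ℕ)) → IsIPFStar A → Split (Join A) ≈* A)
    × ((p : List ℕ) → WIPos p → Join (Split p) ≡ p)
theorem3p4 =
    Join-WIPos
  , (λ _ _ _ _ → Join-≈*)
  , (λ p wp → proj₁ (split-correct _ p wp (enough-fuel p)))
  , (λ A iA → split-join _ A (Join A) iA refl (enough-fuel (Join A)))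
  , (λ p wp → proj₂ (split-correct _ p wp (enough-fuel p)))
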